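{- Let $G$ be a finite simple graph. Then, as simplicial complexes on the underlying set $V(G)$, \[ \mathcal{D}(G)^\vee = \mathcal{N}(\overline{G}). \]
   Context: A simplicial complex here is a pair of a finite underlying set $S$ and a family $K$ of subsets of $S$ closed under taking subsets (elements $v\in S$ with $\{v\}\notin K$ are allowed, "ghost vertices"). For $v\in V(G)$, $N_G(v)$ is the set of vertices adjacent to $v$ and $N_G[v]=N_G(v)\cup\{v\}$. A subset $\sigma\subseteq V(G)$ is dominating in $G$ if every vertex of $G$ lies in $\sigma$ or is adjacent to an element of $\sigma$. The dominance complex $\mathcal{D}(G)$ is the simplicial complex with underlying set $V(G)$ whose simplices are the subsets of $V(G)$ whose complements in $V(G)$ are dominating in $G$. The neighborhood complex $\mathcal{N}(H)$ of a graph $H$ is the simplicial complex with underlying set $V(H)$ whose simplices are the subsets of $V(H)$ contained in $N_H(v)$ for some $v\in V(H)$. $\overline{G}$ is the complement graph (same vertex set, $v,w$ distinct are adjacent iff they are not adjacent in $G$). For a simplicial complex $K$ with underlying set $S$, the combinatorial Alexander dual $K^\vee$ is the simplicial complex with underlying set $S$ whose simplices are the subsets $\sigma\subseteq S$ such that $S\setminus\sigma\notin K$. -}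

module Defs where

open import Level using (Level; 0ℓ) renaming (suc to lsuc)
open import Data.Nat using (ℕ)
open import Data.Fin using (Fin)
open import Data.Fin.Subset using (Subset; _∈_; _∉_; _⊆_; ∁)
open import Data.Product using (Σ; ∃; _×_; _,_)
open import Data.Sum using (_⊎_)
open import Relation.Nullary using (¬_; Dec; yes; no)
open import Data.Fin using (_≟_)
open import Relation.Binary.PropositionalEquality using (_≡_)
open import Function.Bundles using (_⇔_)

record Graph (n : ℕ) : Set₁ where
  field
    Adj     : Fin n → Fin n → Set
    sym     : ∀ {v w} → Adj v w → Adj w v
    irrefl  : ∀ {v} → ¬ Adj v v
    dec     : ∀ v w → Dec (Adj v w)
open Graph public

decC : ∀ {A B : Set} → Dec A → Dec B → Dec (¬ A × ¬ B)
decC (yes a) _ = no λ { (na , _) → na a }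
decC (no na) (yes b) = no λ { (_ , nb) → nb b }
decC (no na) (no nb) = yes (na , nb)

complementGraph : ∀ {n} → Graph n → Graph n
complementGraph G = record
  { Adj    = λ v w → ¬ (v ≡ w) × ¬ Adj G v w
  ; sym    = λ { (v≢w , ¬a) → (λ e → v≢w (Relation.Binary.PropositionalEquality.sym e))
                             , (λ a → ¬a (Graph.sym G a)) }
  ; irrefl = λ { (v≢v , _) → v≢v Relation.Binary.PropositionalEquality.refl }
  ; dec    = λ v w → decC (v ≟ w) (Graph.dec G v w)
  }

-- Simplicial complex with underlying set Fin n (ghost vertices allowed):
-- a family of subsets closed under taking subsets.
record SimplicialComplex (n : ℕ) : Set₁ where
  field
    Face        : Subset n → Set
    downClosed  : ∀ {σ τ} → τ ⊆ σ → Face σ → Face τ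
open SimplicialComplex public

_≅ᶜ_ : ∀ {n} → SimplicialComplex n → SimplicialComplex n → Set
K ≅ᶜ L = ∀ σ → Face K σ ⇔ Face L σ

N : ∀ {n} → Graph n → Fin n → Subset n → Set
N G v σ = ∀ w → w ∈ σ → Adj G v w

Dominating : ∀ {n} → Graph n → Subset n → Set
Dominating G σ = ∀ v → v ∈ σ ⊎ (∃ λ w → w ∈ σ × Adj G v w)

dominanceComplex : ∀ {n} → Graph n → SimplicialComplex n
dominanceComplex G = record
  { Face       = λ σ → Dominating G (∁ σ)
  ; downClosed = λ {σ} {τ} τ⊆σ dom v → helper τ⊆σ (dom v)
  }
  where
  open import Data.Fin.Subset.Properties using (x∈∁p⇒x∉p; x∉p⇒x∈∁p)
  lift : ∀ {σ τ : Subset _} {x} → τ ⊆ σ → x ∈ ∁ σ → x ∈ ∁ τ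
  lift τ⊆σ x∈∁σ = x∉p⇒x∈∁p (λ x∈τ → x∈∁p⇒x∉p x∈∁σ (τ⊆σ x∈τ))
  helper : ∀ {σ τ v} → τ ⊆ σ → v ∈ ∁ σ ⊎ (∃ λ w → w ∈ ∁ σ × Adj G v w)
         → v ∈ ∁ τ ⊎ (∃ λ w → w ∈ ∁ τ × Adj G v w)
  helper τ⊆σ (Data.Sum.inj₁ x) = Data.Sum.inj₁ (lift τ⊆σ x)
  helper τ⊆σ (Data.Sum.inj₂ (w , w∈ , a)) = Data.Sum.inj₂ (w , lift τ⊆σ w∈ , a)

neighborhoodComplex : ∀ {n} → Graph n → SimplicialComplex n
neighborhoodComplex H = record
  { Face       = λ σ → ∃ λ v → N H v σ
  ; downClosed = λ { τ⊆σ (v , h) → v , (λ w w∈τ → h w (τ⊆σ w∈τ)) }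
  }

alexanderDual : ∀ {n} → SimplicialComplex n → SimplicialComplex n
alexanderDual K = record
  { Face       = λ σ → ¬ Face K (∁ σ)
  ; downClosed = λ {σ} {τ} τ⊆σ ¬f f → ¬f (downClosed K (lift τ⊆σ) f)
  }
  where
  open import Data.Fin.Subset.Properties using (x∈∁p⇒x∉p; x∉p⇒x∈∁p)
  lift : ∀ {σ τ : Subset _} → τ ⊆ σ → ∁ σ ⊆ ∁ τ
  lift τ⊆σ x∈∁σ = x∉p⇒x∈∁p (λ x∈τ → x∈∁p⇒x∉p x∈∁σ (τ⊆σ x∈τ))

-- A set σ fails to be dominating exactly when some vertex v is neither in σ
-- nor adjacent to a vertex of σ, i.e. when σ ⊆ N_Ḡ(v): in the complement
-- graph v is adjacent to every vertex of σ. Since σ is a face of 𝒟(G)^∨ iff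
-- ∁ ∁ σ = σ is not dominating, the two complexes have the same faces.
-- Finiteness of V(G) makes "not every vertex is dominated" yield an
-- undominated vertex constructively.
module Submission where

open import Defs
open import Data.Bool using (not)
open import Data.Bool.Properties using (not-involutive)
open import Data.Nat using (ℕ)
open import Data.Fin using (Fin)
open import Data.Fin.Subset using (Subset; _∈_; ∁)
open import Data.Fin.Subset.Properties using (_∈?_)
open import Data.Fin.Properties using (any?; ¬∀⟶∃¬)
open import Data.Vec using (map)
open import Data.Vec.Properties using (map-∘; map-cong; map-id)
open import Data.Product using (∃; _×_; _,_; proj₁; proj₂)
open import Data.Sum using (_⊎_; inj₁; inj₂)
open import Relation.Nullary using (¬_)
open import Relation.Nullary.Decidable using (_⊎-dec_; _×-dec_)
open import Relation.Unary using (Decidable)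
open import Relation.Binary.PropositionalEquality using (_≡_; refl; module ≡-Reasoning)
open import Function using (_∘_; id)
open import Function.Bundles using (_⇔_; mk⇔; Equivalence)

∁-involutive : ∀ {n} (p : Subset n) → ∁ (∁ p) ≡ p
∁-involutive p = begin
  ∁ (∁ p)               ≡⟨ map-∘ not not p ⟨
  map (not ∘ not) p     ≡⟨ map-cong not-involutive p ⟩
  map id p              ≡⟨ map-id p ⟩
  p                     ∎
  where open ≡-Reasoning

module _ {n : ℕ} (G : Graph n) where

  Dominates : Subset n → Fin n → Set
  Dominates σ v = v ∈ σ ⊎ ∃ λ w → w ∈ σ × Adj G v w

  dominates? : ∀ σ → Decidable (Dominates σ)
  dominates? σ v = (v ∈? σ) ⊎-dec any? (λ w → (w ∈? σ) ×-dec dec G v w)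

  N-complementGraph⇔¬Dominates : ∀ σ v → N (complementGraph G) v σ ⇔ (¬ Dominates σ v)
  N-complementGraph⇔¬Dominates σ v = mk⇔ to from
    where
    to : N (complementGraph G) v σ → ¬ Dominates σ v
    to v∼σ (inj₁ v∈σ)            = proj₁ (v∼σ v v∈σ) refl
    to v∼σ (inj₂ (w , w∈σ , vw)) = proj₂ (v∼σ w w∈σ) vw

    from : ¬ Dominates σ v → N (complementGraph G) v σ
    from ¬dom w w∈σ = (λ { refl → ¬dom (inj₁ w∈σ) }) , (λ vw → ¬dom (inj₂ (w , w∈σ , vw)))

  ¬Dominating⇔∃N-complementGraph : ∀ σ → (¬ Dominating G σ) ⇔ (∃ λ v → N (complementGraph G) v σ)
  ¬Dominating⇔∃N-complementGraph σ = mk⇔ to from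
    where
    to : ¬ Dominating G σ → ∃ λ v → N (complementGraph G) v σ
    to ¬dom = let v , ¬dom-v = ¬∀⟶∃¬ n (Dominates σ) (dominates? σ) ¬dom
              in v , Equivalence.from (N-complementGraph⇔¬Dominates σ v) ¬dom-v

    from : (∃ λ v → N (complementGraph G) v σ) → ¬ Dominating G σ
    from (v , v∼σ) dom = Equivalence.to (N-complementGraph⇔¬Dominates σ v) v∼σ (dom v)

theorem1p1 : ∀ (n : ℕ) (G : Graph n) →
    alexanderDual (dominanceComplex G) ≅ᶜ neighborhoodComplex (complementGraph G)
theorem1p1 n G σ rewrite ∁-involutive σ = ¬Dominating⇔∃N-complementGraph G σ
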